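{- Let $G$ be a graph with $\operatorname{th}_c(G)=q$, and let \[I(q)=\begin{cases}\left\{\left(\frac{q+1}{2},\frac{q-1}{2}\right)\right\}, & q\text{ odd},\\[2pt] \left\{\left(\frac q2,\frac q2\right),\left(\frac{q+2}{2},\frac{q-2}{2}\right)\right\}, & q\text{ even}.\end{cases}\] Then $\operatorname{th}_c^{\times}(G)=\left\lfloor\frac{(q+1)^2}{4}\right\rfloor$ if and only if every sum-minimum throttling point of $G$ is contained in $I(q)$ and at least one such throttling point is also product-minimum.
   Context: In the game of Cops and Robbers, the cops first occupy a multiset $S$ of vertices, then the robber chooses a vertex; in each round every cop moves to an adjacent vertex or stays, then the robber does likewise; perfect information; capture occurs when a cop occupies the robber's vertex. $\operatorname{capt}(G;S)$ is the optimal-play number of rounds to capture with cops starting on $S$ ($\infty$ if not guaranteed); $S$ is a capture set if this is finite. $\operatorname{capt}_k(G)=\min_{|S|=k}\operatorname{capt}(G;S)$; $\operatorname{th}_c(G)=\min_k\{k+\operatorname{capt}_k(G)\}$; $\operatorname{th}_c^{\times}(G)=\min_k\{k(1+\operatorname{capt}_k(G))\}$. An ordered pair $(k,p)$ is a throttling point of $G$ if there is a capture set $S$ with $|S|=k$ and $\operatorname{capt}(G;S)=p$. A throttling point $(k,p)$ is sum-minimum if $k+p=\operatorname{th}_c(G)$ and product-minimum if $k(1+p)=\operatorname{th}_c^{\times}(G)$. -}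

module Defs where

open import Data.Nat using (ℕ; zero; suc; _+_; _*_; _≤_; _/_; _%_)
open import Data.Fin using (Fin)
open import Data.Vec using (Vec)
open import Data.Vec.Membership.Propositional using (_∈_)
open import Data.Vec.Relation.Binary.Pointwise.Inductive using (Pointwise)
open import Data.Product using (Σ; ∃; ∃-syntax; _×_; _,_)
open import Data.Sum using (_⊎_)
open import Data.Empty using (⊥)
open import Relation.Nullary using (¬_)
open import Relation.Binary.PropositionalEquality using (_≡_)

record Graph : Set₁ where
  field
    n      : ℕ
    Adj    : Fin n → Fin n → Set
    sym    : ∀ {u v} → Adj u v → Adj v u
    irrefl : ∀ {u} → ¬ Adj u u

module _ (G : Graph) where
  open Graph G

  Step : Fin n → Fin n → Set
  Step u v = u ≡ v ⊎ Adj u v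

  -- simultaneous move of all k cops (a cop configuration is a Vec,
  -- i.e. a multiset of vertices with labelled cops)
  CopMove : ∀ {k} → Vec (Fin n) k → Vec (Fin n) k → Set
  CopMove = Pointwise Step

  -- Win p c r : cops at c, robber at r, cops to move;
  -- the cops can guarantee capture within p further rounds.
  Win : ℕ → ∀ {k} → Vec (Fin n) k → Fin n → Set
  Win zero    c r = r ∈ c
  Win (suc p) c r =
    r ∈ c ⊎ (Σ (Vec (Fin n) _) λ c' → CopMove c c' ×
               (r ∈ c' ⊎ (∀ r' → Step r r' → Win p c' r')))

  CaptWithin : ∀ {k} → Vec (Fin n) k → ℕ → Set
  CaptWithin S p = ∀ r → Win p S r

  Capt : ∀ {k} → Vec (Fin n) k → ℕ → Set
  Capt S p = CaptWithin S p × (∀ p' → CaptWithin S p' → p ≤ p')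

  ThrottlingPoint : ℕ → ℕ → Set
  ThrottlingPoint k p = Σ (Vec (Fin n) k) λ S → Capt S p

  ThC : ℕ → Set
  ThC q = (∃[ k ] ∃[ p ] (ThrottlingPoint k p × k + p ≡ q))
        × (∀ k p → ThrottlingPoint k p → q ≤ k + p)

  ThCx : ℕ → Set
  ThCx m = (∃[ k ] ∃[ p ] (ThrottlingPoint k p × k * (1 + p) ≡ m))
         × (∀ k p → ThrottlingPoint k p → m ≤ k * (1 + p))

  SumMin : ℕ → ℕ → Set
  SumMin k p = ThrottlingPoint k p × (∀ k' p' → ThrottlingPoint k' p' → k + p ≤ k' + p')

  ProdMin : ℕ → ℕ → Set
  ProdMin k p = ThrottlingPoint k p
              × (∀ k' p' → ThrottlingPoint k' p' → k * (1 + p) ≤ k' * (1 + p'))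

-- (k , p) ∈ I(q), with the halves written multiplied out (exact in ℕ)
InI : ℕ → ℕ → ℕ → Set
InI q k p =
    (q % 2 ≡ 1 × 2 * k ≡ q + 1 × 2 * p + 1 ≡ q)
  ⊎ (q % 2 ≡ 0 × ((2 * k ≡ q × 2 * p ≡ q) ⊎ (2 * k ≡ q + 2 × 2 * p + 2 ≡ q)))

bound : ℕ → ℕ
bound q = (suc q * suc q) / 4

-- For k + p = q the two factors of k (1 + p) sum to q + 1, so by AM–GM
-- k (1 + p) ≤ ⌊(q + 1)² / 4⌋, with equality exactly when k and 1 + p differ by
-- at most one, i.e. when (k , p) ∈ I(q).  Since th_c^× is the minimum of k (1 + p)
-- over all throttling points, it attains this bound iff some sum-minimum point
-- attains it; and then every sum-minimum point is forced into I(q).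
module Submission where

open import Defs
open import Data.Nat using (ℕ; zero; suc; _+_; _*_; _≤_; _/_; _%_; ∣_-_∣; z≤n; s≤s; NonZero)
open import Data.Nat.Properties
open import Data.Nat.DivMod using (+-distrib-/-∣ʳ; m*n/n≡m; m/n≡0⇒m<n; [m+kn]%n≡m%n; m*n%n≡0)
open import Data.Nat.Divisibility using (n∣m*n)
open import Data.Nat.Tactic.RingSolver using (solve-∀)
open import Data.Product using (_×_; ∃-syntax; _,_)
open import Data.Sum using (_⊎_; inj₁; inj₂; map)
open import Function.Bundles using (_⇔_; mk⇔; Equivalence)
open import Function.Construct.Composition using (_⇔-∘_)
open import Function.Construct.Symmetry using (⇔-sym)
open import Relation.Binary.PropositionalEquality
open import Relation.Nullary using (contradiction)

[m+kn]/n≡m/n+k : ∀ m k n .{{_ : NonZero n}} → (m + k * n) / n ≡ m / n + k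
[m+kn]/n≡m/n+k m k n = trans (+-distrib-/-∣ʳ m (n∣m*n k)) (cong (m / n +_) (m*n/n≡m k n))

[m+n]²≡∣m-n∣²+4mn-≤ : ∀ {m n} → m ≤ n → (m + n) * (m + n) ≡ ∣ m - n ∣ * ∣ m - n ∣ + m * n * 4
[m+n]²≡∣m-n∣²+4mn-≤ {m} m≤n with m≤n⇒∃[o]m+o≡n m≤n
... | d , refl rewrite ∣m-m+n∣≡n m d = identity m d
  where
  identity : ∀ m d → (m + (m + d)) * (m + (m + d)) ≡ d * d + m * (m + d) * 4
  identity = solve-∀

[m+n]²≡∣m-n∣²+4mn : ∀ m n → (m + n) * (m + n) ≡ ∣ m - n ∣ * ∣ m - n ∣ + m * n * 4
[m+n]²≡∣m-n∣²+4mn m n with ≤-total m n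
... | inj₁ m≤n = [m+n]²≡∣m-n∣²+4mn-≤ m≤n
... | inj₂ n≤m = begin
  (m + n) * (m + n)                  ≡⟨ cong (λ t → t * t) (+-comm m n) ⟩
  (n + m) * (n + m)                  ≡⟨ [m+n]²≡∣m-n∣²+4mn-≤ n≤m ⟩
  ∣ n - m ∣ * ∣ n - m ∣ + n * m * 4  ≡⟨ cong₂ (λ a b → a * a + b * 4) (∣-∣-comm n m) (*-comm n m) ⟩
  ∣ m - n ∣ * ∣ m - n ∣ + m * n * 4  ∎
  where open ≡-Reasoning

[m+n]²/4≡mn+∣m-n∣²/4 : ∀ m n → (m + n) * (m + n) / 4 ≡ m * n + ∣ m - n ∣ * ∣ m - n ∣ / 4
[m+n]²/4≡mn+∣m-n∣²/4 m n = begin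
  (m + n) * (m + n) / 4                    ≡⟨ cong (_/ 4) ([m+n]²≡∣m-n∣²+4mn m n) ⟩
  (∣ m - n ∣ * ∣ m - n ∣ + m * n * 4) / 4  ≡⟨ [m+kn]/n≡m/n+k (∣ m - n ∣ * ∣ m - n ∣) (m * n) 4 ⟩
  ∣ m - n ∣ * ∣ m - n ∣ / 4 + m * n        ≡⟨ +-comm (∣ m - n ∣ * ∣ m - n ∣ / 4) (m * n) ⟩
  m * n + ∣ m - n ∣ * ∣ m - n ∣ / 4        ∎
  where open ≡-Reasoning

n²/4≡0⇔n≤1 : ∀ n → (n * n / 4 ≡ 0 ⇔ n ≤ 1)
n²/4≡0⇔n≤1 n = mk⇔ (to n) from
  where
  to : ∀ n → n * n / 4 ≡ 0 → n ≤ 1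
  to zero          _ = z≤n
  to (suc zero)    _ = s≤s z≤n
  to (suc (suc n)) n²/4≡0 =
    contradiction (*-mono-≤ (m≤m+n 2 n) (m≤m+n 2 n)) (<⇒≱ (m/n≡0⇒m<n n²/4≡0))
  from : n ≤ 1 → n * n / 4 ≡ 0
  from z≤n       = refl
  from (s≤s z≤n) = refl

m*n≤[m+n]²/4 : ∀ m n → m * n ≤ (m + n) * (m + n) / 4
m*n≤[m+n]²/4 m n = subst (m * n ≤_) (sym ([m+n]²/4≡mn+∣m-n∣²/4 m n)) (m≤m+n (m * n) _)

m≡m+n⇔n≡0 : ∀ m n → (m ≡ m + n ⇔ n ≡ 0)
m≡m+n⇔n≡0 m n = mk⇔ (λ m≡m+n → sym (+-cancelˡ-≡ m 0 n (trans (+-identityʳ m) m≡m+n)))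
                    (λ { refl → sym (+-identityʳ m) })

m*n≡[m+n]²/4⇔∣m-n∣≤1 : ∀ m n → (m * n ≡ (m + n) * (m + n) / 4 ⇔ ∣ m - n ∣ ≤ 1)
m*n≡[m+n]²/4⇔∣m-n∣≤1 m n rewrite [m+n]²/4≡mn+∣m-n∣²/4 m n =
  n²/4≡0⇔n≤1 ∣ m - n ∣ ⇔-∘ m≡m+n⇔n≡0 (m * n) (∣ m - n ∣ * ∣ m - n ∣ / 4)

∣n-1+n∣≡1 : ∀ n → ∣ n - suc n ∣ ≡ 1
∣n-1+n∣≡1 zero    = refl
∣n-1+n∣≡1 (suc n) = ∣n-1+n∣≡1 n

∣m-n∣≤1⇔ : ∀ m n → (∣ m - n ∣ ≤ 1 ⇔ (suc m ≡ n ⊎ m ≡ n ⊎ m ≡ suc n))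
∣m-n∣≤1⇔ m n = mk⇔ (to m n) from
  where
  to : ∀ m n → ∣ m - n ∣ ≤ 1 → suc m ≡ n ⊎ m ≡ n ⊎ m ≡ suc n
  to zero          zero          _ = inj₂ (inj₁ refl)
  to zero          (suc zero)    _ = inj₁ refl
  to (suc zero)    zero          _ = inj₂ (inj₂ refl)
  to (suc m)       (suc n)       ∣m-n∣≤1 =
    map (cong suc) (map (cong suc) (cong suc)) (to m n ∣m-n∣≤1)
  to zero          (suc (suc n)) (s≤s ())
  to (suc (suc m)) zero          (s≤s ())
  from : suc m ≡ n ⊎ m ≡ n ⊎ m ≡ suc n → ∣ m - n ∣ ≤ 1
  from (inj₁ refl)        = ≤-reflexive (∣n-1+n∣≡1 m)
  from (inj₂ (inj₁ refl)) = subst (_≤ 1) (sym (∣n-n∣≡0 m)) z≤n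
  from (inj₂ (inj₂ refl)) = ≤-reflexive (trans (∣-∣-comm (suc n) n) (∣n-1+n∣≡1 n))

2*m≡m+n⇒m≡n : ∀ m n → 2 * m ≡ m + n → m ≡ n
2*m≡m+n⇒m≡n m n 2m≡m+n = +-cancelˡ-≡ m m n (trans (cong (m +_) (sym (+-identityʳ m))) 2m≡m+n)

InI-sum⇔ : ∀ k p → (InI (k + p) k p ⇔ (suc k ≡ suc p ⊎ k ≡ suc p ⊎ k ≡ suc (suc p)))
InI-sum⇔ k p = mk⇔ to from
  where
  to : InI (k + p) k p → suc k ≡ suc p ⊎ k ≡ suc p ⊎ k ≡ suc (suc p)
  to (inj₁ (_ , 2k≡q+1 , _)) =
    inj₂ (inj₁ (trans (2*m≡m+n⇒m≡n k (p + 1) (trans 2k≡q+1 (+-assoc k p 1))) (+-comm p 1)))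
  to (inj₂ (_ , inj₁ (2k≡q , _))) = inj₁ (cong suc (2*m≡m+n⇒m≡n k p 2k≡q))
  to (inj₂ (_ , inj₂ (2k≡q+2 , _))) =
    inj₂ (inj₂ (trans (2*m≡m+n⇒m≡n k (p + 2) (trans 2k≡q+2 (+-assoc k p 2))) (+-comm p 2)))
  from : suc k ≡ suc p ⊎ k ≡ suc p ⊎ k ≡ suc (suc p) → InI (k + p) k p
  from (inj₁ refl) =
    inj₂ (trans (cong (_% 2) (p+p≡p*2 p)) (m*n%n≡0 p 2) , inj₁ (2p≡p+p p , 2p≡p+p p))
    where
    p+p≡p*2 : ∀ p → p + p ≡ p * 2
    p+p≡p*2 = solve-∀
    2p≡p+p : ∀ p → 2 * p ≡ p + p
    2p≡p+p = solve-∀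
  from (inj₂ (inj₁ refl)) =
    inj₁ (trans (cong (_% 2) (q≡1+p*2 p)) ([m+kn]%n≡m%n 1 p 2) , 2k≡q+1 p , 2p+1≡q p)
    where
    q≡1+p*2 : ∀ p → suc p + p ≡ 1 + p * 2
    q≡1+p*2 = solve-∀
    2k≡q+1 : ∀ p → 2 * suc p ≡ (suc p + p) + 1
    2k≡q+1 = solve-∀
    2p+1≡q : ∀ p → 2 * p + 1 ≡ suc p + p
    2p+1≡q = solve-∀
  from (inj₂ (inj₂ refl)) =
    inj₂ (trans (cong (_% 2) (q≡[1+p]*2 p)) (m*n%n≡0 (suc p) 2) , inj₂ (2k≡q+2 p , 2p+2≡q p))
    where
    q≡[1+p]*2 : ∀ p → suc (suc p) + p ≡ suc p * 2
    q≡[1+p]*2 = solve-∀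
    2k≡q+2 : ∀ p → 2 * suc (suc p) ≡ (suc (suc p) + p) + 2
    2k≡q+2 = solve-∀
    2p+2≡q : ∀ p → 2 * p + 2 ≡ suc (suc p) + p
    2p+2≡q = solve-∀

bound-sum : ∀ k p → bound (k + p) ≡ (k + suc p) * (k + suc p) / 4
bound-sum k p = cong (λ t → t * t / 4) (sym (+-suc k p))

*-suc≤bound : ∀ k p {q} → k + p ≡ q → k * suc p ≤ bound q
*-suc≤bound k p refl = subst (k * suc p ≤_) (sym (bound-sum k p)) (m*n≤[m+n]²/4 k (suc p))

*-suc≡bound⇔InI : ∀ k p {q} → k + p ≡ q → (k * suc p ≡ bound q ⇔ InI q k p)
*-suc≡bound⇔InI k p refl rewrite bound-sum k p =
  ⇔-sym (InI-sum⇔ k p) ⇔-∘ (∣m-n∣≤1⇔ k (suc p) ⇔-∘ m*n≡[m+n]²/4⇔∣m-n∣≤1 k (suc p))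

module _ {G : Graph} where

  sumMin⇒sum≡ : ∀ {q k p} → ThC G q → SumMin G k p → k + p ≡ q
  sumMin⇒sum≡ {k = k} {p} ((k₀ , p₀ , tp₀ , k₀+p₀≡q) , minimal) (tp , least) =
    ≤-antisym (subst (k + p ≤_) k₀+p₀≡q (least k₀ p₀ tp₀)) (minimal k p tp)

  sum≡⇒sumMin : ∀ {q k p} → ThC G q → ThrottlingPoint G k p → k + p ≡ q → SumMin G k p
  sum≡⇒sumMin (_ , minimal) tp refl = tp , minimal

  product≡⇒prodMin : ∀ {m k p} → ThCx G m → ThrottlingPoint G k p → k * suc p ≡ m → ProdMin G k p
  product≡⇒prodMin (_ , minimal) tp refl = tp , minimal

  prodMin⇒ThCx : ∀ {k p} → ProdMin G k p → ThCx G (k * suc p)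
  prodMin⇒ThCx {k} {p} (tp , least) = (k , p , tp , refl) , least

proposition4p8 : (G : Graph) (q : ℕ) → ThC G q →
    (ThCx G (bound q) ⇔
      ((∀ k p → SumMin G k p → InI q k p) × (∃[ k ] ∃[ p ] (SumMin G k p × ProdMin G k p))))
proposition4p8 G q thc@((k₀ , p₀ , tp₀ , k₀+p₀≡q) , _) = mk⇔ to from
  where
  to : ThCx G (bound q) →
       (∀ k p → SumMin G k p → InI q k p) × (∃[ k ] ∃[ p ] (SumMin G k p × ProdMin G k p))
  to thcx@(_ , minimal) =
    sumMin⇒InI , k₀ , p₀ , sum≡⇒sumMin thc tp₀ k₀+p₀≡q , product≡⇒prodMin thcx tp₀ k₀-attains
    where
    sumMin⇒InI : ∀ k p → SumMin G k p → InI q k p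
    sumMin⇒InI k p sm@(tp , _) = Equivalence.to (*-suc≡bound⇔InI k p k+p≡q)
      (≤-antisym (*-suc≤bound k p k+p≡q) (minimal k p tp))
      where
      k+p≡q : k + p ≡ q
      k+p≡q = sumMin⇒sum≡ thc sm
    k₀-attains : k₀ * suc p₀ ≡ bound q
    k₀-attains = ≤-antisym (*-suc≤bound k₀ p₀ k₀+p₀≡q) (minimal k₀ p₀ tp₀)
  from : (∀ k p → SumMin G k p → InI q k p) × (∃[ k ] ∃[ p ] (SumMin G k p × ProdMin G k p)) →
         ThCx G (bound q)
  from (allInI , k , p , sm , pm) = subst (ThCx G) k-attains (prodMin⇒ThCx pm)
    where
    k-attains : k * suc p ≡ bound q
    k-attains = Equivalence.from (*-suc≡bound⇔InI k p (sumMin⇒sum≡ thc sm)) (allInI k p sm)
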